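{- Let $m\ge 2$ and $k\ge 1$ be integers. Define polynomials $P_{k,j}(x)$ ($0\le j\le k$) and $Q_k(x)$ in $\mathbb{Z}[x]$ recursively by $P_{0,0}(x)=1$, $Q_0(x)=-1$, and for $k\ge 1$: \[ P_{k,0}(x)=x^{m^{k-1}-1}P_{k-1,0}(x),\qquad P_{k,k}(x)=-P_{k-1,k-1}(x),\qquad Q_k(x)=x^{m^{k-1}}Q_{k-1}(x), \] \[ P_{k,j}(x)=x^{m^{k-1}-m^{j}}P_{k-1,j}(x)-x^{m^{k-1}-m^{j-1}}P_{k-1,j-1}(x)\quad\text{for } j\in\{1,\ldots,k-1\}. \] Then the power series $A_m(k,x)$ satisfies \[ \sum_{j=0}^{k}P_{k,j}(x)A_m\big(k,x^{m^j}\big)+Q_k(x)=0. \]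
   Context: For integers $m\ge 2$, $k\ge 0$, $n\ge 0$, $a_m(k,n)$ denotes the number of partitions of $n$ into exactly $k$ parts, each a power of $m$, and $A_m(k,x):=\sum_{n=0}^{\infty}a_m(k,n)x^n$. -}

module Defs where

open import Data.Bool using (Bool; true; false; if_then_else_; _∧_)
open import Data.Nat as ℕ using (ℕ; zero; suc; _∸_; _^_; _≡ᵇ_; _<ᵇ_; _≤ᵇ_)
open import Data.Integer as ℤ using (ℤ; +_; -_)
open import Data.List using (List; []; _∷_; _++_; length; map; concatMap; upTo; replicate; filterᵇ)

-- A partition of n into exactly k parts, each a power of m, is a multiset
-- {m^e₁,…,m^e_k} with Σ m^eᵢ = n.  Since e ↦ m^e is injective for m ≥ 2,
-- such a multiset is the same as a nondecreasing list of exponents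
-- e₁ ≤ … ≤ e_k with Σ m^eᵢ = n.  Each exponent satisfies m^e ≤ n, hence
-- e ≤ n, so it suffices to enumerate exponent lists over {0,…,n}.

allLists : ℕ → ℕ → List (List ℕ)
allLists zero    b = [] ∷ []
allLists (suc k) b = concatMap (λ e → map (e ∷_) (allLists k b)) (upTo (suc b))

nondecreasing : List ℕ → Bool
nondecreasing []           = true
nondecreasing (x ∷ [])     = true
nondecreasing (x ∷ y ∷ xs) = (x ≤ᵇ y) ∧ nondecreasing (y ∷ xs)

sumℕ : List ℕ → ℕ
sumℕ []       = 0
sumℕ (x ∷ xs) = x ℕ.+ sumℕ xs

isPartition : ℕ → ℕ → List ℕ → Bool
isPartition m n es = nondecreasing es ∧ (sumℕ (map (m ^_) es) ≡ᵇ n)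

a : ℕ → ℕ → ℕ → ℕ
a m k n = length (filterᵇ (isPartition m n) (allLists k n))

-- Formal power series over ℤ (coefficient sequences) and polynomials
-- (coefficient lists, lowest degree first).

Series : Set
Series = ℕ → ℤ

Poly : Set
Poly = List ℤ

coeff : Poly → ℕ → ℤ
coeff []       n       = + 0
coeff (c ∷ cs) zero    = c
coeff (c ∷ cs) (suc n) = coeff cs n

Σ< : ℕ → (ℕ → ℤ) → ℤ
Σ< zero    f = + 0
Σ< (suc n) f = Σ< n f ℤ.+ f n

A : ℕ → ℕ → Series
A m k n = + a m k n

-- coefficients of f(x^e), for e ≥ 1: [x^N] f(x^e) = Σ_{t ≤ N, e t = N} f_t
substPow : ℕ → Series → Series
substPow e f N = Σ< (suc N) (λ t → if (e ℕ.* t) ≡ᵇ N then f t else + 0)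

_⊙_ : Poly → Series → Series
(p ⊙ f) n = Σ< (suc n) (λ i → coeff p i ℤ.* f (n ∸ i))

_⊕_ : Series → Series → Series
(f ⊕ g) n = f n ℤ.+ g n

polySeries : Poly → Series
polySeries p n = coeff p n

ΣS≤ : ℕ → (ℕ → Series) → Series
ΣS≤ k F n = Σ< (suc k) (λ j → F j n)

addP : Poly → Poly → Poly
addP []       q        = q
addP (c ∷ cs) []       = c ∷ cs
addP (c ∷ cs) (d ∷ ds) = (c ℤ.+ d) ∷ addP cs ds

negP : Poly → Poly
negP = map (-_)

subP : Poly → Poly → Poly
subP p q = addP p (negP q)

shiftP : ℕ → Poly → Poly
shiftP d p = replicate d (+ 0) ++ p

-- The polynomials P_{k,j} and Q_k (parameter m).  P m k j is only
-- meaningful for j ≤ k; for j > k it is set to 0 (never used).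

P : ℕ → ℕ → ℕ → Poly
P m zero    zero    = + 1 ∷ []
P m zero    (suc j) = []
P m (suc k) zero    = shiftP (m ^ k ∸ 1) (P m k zero)
P m (suc k) (suc j) =
  if j ≡ᵇ k then negP (P m k k)
  else if j <ᵇ k then
    subP (shiftP (m ^ k ∸ m ^ suc j) (P m k (suc j)))
         (shiftP (m ^ k ∸ m ^ j) (P m k j))
  else []

Q : ℕ → ℕ → Poly
Q m zero    = - (+ 1) ∷ []
Q m (suc k) = shiftP (m ^ k) (Q m k)

LHS : ℕ → ℕ → Series
LHS m k = ΣS≤ k (λ j → P m k j ⊙ substPow (m ^ j) (A m k)) ⊕ polySeries (Q m k)

{-# OPTIONS --safe #-}

-- A partition of n + 1 into k + 1 powers of m either has a part 1, or all of its
-- parts are divisible by m; hence A_m(k+1,x) = x A_m(k,x) + A_m(k+1,x^m).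
-- Put L_k(F) = Σ_j P_{k,j}(x) F(x^{m^j}) + Q_k(x).  If x G(x) = F(x) − F(x^m), then
-- x^{m^k} P_{k,j}(x) G(x^{m^j}) = x^{m^k − m^j} P_{k,j}(x) (F(x^{m^j}) − F(x^{m^{j+1}})),
-- and summation by parts turns the recursion for P_{k+1,j} into
-- L_{k+1}(F) = x^{m^k} L_k(G).  Since L_0(A_m(0,·)) = 1 − 1 = 0, induction on k
-- gives L_k(A_m(k,·)) = 0 for every k.

module Submission where

open import Defs

open import Data.Bool using (Bool; true; false; T; if_then_else_; _∧_)
open import Data.Bool.Properties using (T-∧; ∧-assoc; ∧-zeroʳ; if-cong)
open import Data.Integer using (ℤ; +_; -_; +0; _+_; _-_; _*_)
import Data.Integer.Properties as ℤ
open import Data.Integer.Tactic.RingSolver using (solve-∀)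
open import Data.List using (List; []; _∷_; _++_; map; concatMap; applyUpTo; upTo; length; filterᵇ)
import Data.List.Properties as List
open import Data.Nat
  using (ℕ; zero; suc; _∸_; _^_; _≤_; _<_; z≤n; s≤s; z<s; _≡ᵇ_; _≤ᵇ_; NonZero; >-nonZero)
import Data.Nat as ℕ
import Data.Nat.Properties as ℕ
open import Data.Nat.Divisibility
  using (_∤_; divides; _∣?_; _∣0; m∣m*n; m*n∣⇒n∣; *-cancelʳ-∣; ∣-refl; ∣m∸n∣n⇒∣m)
open import Data.Nat.ListAction using (sum)
open import Data.Product using (_×_; _,_; proj₂)
open import Data.Sum using (inj₁; inj₂)
open import Data.Unit using (tt)
open import Function using (_∘_; mk⇔; Equivalence)
open import Relation.Binary.PropositionalEquality
open import Relation.Nullary using (¬_; yes; no; contradiction)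
open import Relation.Nullary.Decidable using (does-⇔; T?; _×-dec_)

open import Algebra.Properties.CommutativeSemigroup ℤ.+-commutativeSemigroup using (interchange)
open import Algebra.Properties.Ring ℤ.+-*-ring using ([y-z]x≈yx-zx; x[y-z]≈xy-xz)

open ≡-Reasoning

if-T : ∀ {A : Set} {c} {x y : A} → T c → (if c then x else y) ≡ x
if-T {c = true} _ = refl

if-¬T : ∀ {A : Set} {c} {x y : A} → ¬ T c → (if c then x else y) ≡ y
if-¬T {c = false} _  = refl
if-¬T {c = true}  ¬c = contradiction tt ¬c

if-else-≡ : ∀ {A : Set} {c} {x y : A} → (T c → x ≡ y) → (if c then x else y) ≡ y
if-else-≡ {c = false} _  = refl
if-else-≡ {c = true}  eq = eq tt

Σ<-cong : ∀ n {f g : ℕ → ℤ} → (∀ i → i < n → f i ≡ g i) → Σ< n f ≡ Σ< n g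
Σ<-cong zero    eq = refl
Σ<-cong (suc n) eq = cong₂ _+_ (Σ<-cong n (λ i i<n → eq i (ℕ.m<n⇒m<1+n i<n))) (eq n ℕ.≤-refl)

Σ<-+ : ∀ n (f g : ℕ → ℤ) → Σ< n (λ i → f i + g i) ≡ Σ< n f + Σ< n g
Σ<-+ zero    f g = refl
Σ<-+ (suc n) f g = trans (cong (_+ (f n + g n)) (Σ<-+ n f g)) (interchange (Σ< n f) (Σ< n g) (f n) (g n))

Σ<-neg : ∀ n (f : ℕ → ℤ) → Σ< n (λ i → - f i) ≡ - Σ< n f
Σ<-neg zero    f = refl
Σ<-neg (suc n) f = trans (cong (_- f n) (Σ<-neg n f)) (sym (ℤ.neg-distrib-+ (Σ< n f) (f n)))

Σ<-minus : ∀ n (f g : ℕ → ℤ) → Σ< n (λ i → f i - g i) ≡ Σ< n f - Σ< n g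
Σ<-minus n f g = trans (Σ<-+ n f (-_ ∘ g)) (cong (_+_ (Σ< n f)) (Σ<-neg n g))

Σ<-zero : ∀ n {f : ℕ → ℤ} → (∀ i → i < n → f i ≡ +0) → Σ< n f ≡ +0
Σ<-zero zero    eq = refl
Σ<-zero (suc n) eq = cong₂ _+_ (Σ<-zero n (λ i i<n → eq i (ℕ.m<n⇒m<1+n i<n))) (eq n ℕ.≤-refl)

Σ<-head : ∀ n (f : ℕ → ℤ) → Σ< (suc n) f ≡ f 0 + Σ< n (f ∘ suc)
Σ<-head zero    f = trans (ℤ.+-identityˡ (f 0)) (sym (ℤ.+-identityʳ (f 0)))
Σ<-head (suc n) f = trans (cong (_+ f (suc n)) (Σ<-head n f)) (ℤ.+-assoc (f 0) _ _)

Σ<-single : ∀ n q {f : ℕ → ℤ} → q < n → (∀ i → i < n → i ≢ q → f i ≡ +0) → Σ< n f ≡ f q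
Σ<-single (suc n) q {f} q<1+n off with q ℕ.≟ n
... | yes refl = trans (cong (_+ f q) (Σ<-zero n (λ i i<q → off i (ℕ.m<n⇒m<1+n i<q) (ℕ.<⇒≢ i<q))))
                       (ℤ.+-identityˡ (f q))
... | no  q≢n  = trans (cong₂ _+_ rest (off n ℕ.≤-refl (q≢n ∘ sym))) (ℤ.+-identityʳ (f q))
  where
  rest : Σ< n f ≡ f q
  rest = Σ<-single n q (ℕ.≤∧≢⇒< (ℕ.≤-pred q<1+n) q≢n) (λ i i<n → off i (ℕ.m<n⇒m<1+n i<n))

Σ<-by-parts : ∀ k (u v w : ℕ → ℤ) → w 0 ≡ u 0 → (∀ j → j < k → w (suc j) ≡ u (suc j) - v j) →
              w (suc k) ≡ - v k → Σ< (suc (suc k)) w ≡ Σ< (suc k) (λ j → u j - v j)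
Σ<-by-parts k u v w w₀ w-suc w-last = begin
  Σ< (suc k) w + w (suc k)                      ≡⟨ cong₂ _+_ (partial-sums k ℕ.≤-refl) w-last ⟩
  (Σ< (suc k) (λ j → u j - v j) + v k) - v k    ≡⟨ x+y-y≡x _ (v k) ⟩
  Σ< (suc k) (λ j → u j - v j)                  ∎
  where
  x+y-y≡x : ∀ x y → (x + y) - y ≡ x
  x+y-y≡x = solve-∀

  partial-sums : ∀ K → K ≤ k → Σ< (suc K) w ≡ Σ< (suc K) (λ j → u j - v j) + v K
  partial-sums zero    _   = trans (cong (_+_ +0) w₀) (regroup (u 0) (v 0))
    where
    regroup : ∀ x y → +0 + x ≡ (+0 + (x - y)) + y
    regroup = solve-∀
  partial-sums (suc K) K<k = begin
    Σ< (suc K) w + w (suc K)                        ≡⟨ cong₂ _+_ (partial-sums K (ℕ.<⇒≤ K<k)) (w-suc K K<k) ⟩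
    (Sₖ + v K) + (u (suc K) - v K)                  ≡⟨ regroup Sₖ (v K) (u (suc K)) (v (suc K)) ⟩
    Σ< (suc (suc K)) (λ j → u j - v j) + v (suc K)  ∎
    where
    Sₖ : ℤ
    Sₖ = Σ< (suc K) (λ j → u j - v j)
    regroup : ∀ S a b c → (S + a) + (b - a) ≡ (S + (b - c)) + c
    regroup = solve-∀

infix 4 _≈_
_≈_ : Series → Series → Set
f ≈ g = ∀ n → f n ≡ g n

0S : Series
0S _ = +0

_⊖_ : Series → Series → Series
(f ⊖ g) n = f n - g n

shift₁ : Series → Series
shift₁ f zero    = +0
shift₁ f (suc n) = f n

shiftS : ℕ → Series → Series
shiftS zero    f = f
shiftS (suc d) f = shift₁ (shiftS d f)

shiftS-cong : ∀ d {f g} → f ≈ g → shiftS d f ≈ shiftS d g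
shiftS-cong zero    eq n       = eq n
shiftS-cong (suc d) eq zero    = refl
shiftS-cong (suc d) eq (suc n) = shiftS-cong d eq n

shiftS-+ : ∀ a b f → shiftS (a ℕ.+ b) f ≈ shiftS a (shiftS b f)
shiftS-+ zero    b f n       = refl
shiftS-+ (suc a) b f zero    = refl
shiftS-+ (suc a) b f (suc n) = shiftS-+ a b f n

shiftS-< : ∀ d f {N} → N < d → shiftS d f N ≡ +0
shiftS-< (suc d) f {zero}  _           = refl
shiftS-< (suc d) f {suc N} (s≤s N<d) = shiftS-< d f N<d

shiftS-≥ : ∀ d f {N} → d ≤ N → shiftS d f N ≡ f (N ∸ d)
shiftS-≥ zero    f _         = refl
shiftS-≥ (suc d) f (s≤s d≤N) = shiftS-≥ d f d≤N

shiftS-0S : ∀ d → shiftS d 0S ≈ 0S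
shiftS-0S zero    n       = refl
shiftS-0S (suc d) zero    = refl
shiftS-0S (suc d) (suc n) = shiftS-0S d n

shiftS-⊕ : ∀ d f g → shiftS d (f ⊕ g) ≈ shiftS d f ⊕ shiftS d g
shiftS-⊕ zero    f g n       = refl
shiftS-⊕ (suc d) f g zero    = refl
shiftS-⊕ (suc d) f g (suc n) = shiftS-⊕ d f g n

shiftS-ΣS≤ : ∀ d k (F : ℕ → Series) → shiftS d (ΣS≤ k F) ≈ ΣS≤ k (λ j → shiftS d (F j))
shiftS-ΣS≤ d k F N with ℕ.<-≤-connex N d
... | inj₁ N<d = trans (shiftS-< d _ N<d) (sym (Σ<-zero (suc k) (λ j _ → shiftS-< d (F j) N<d)))
... | inj₂ d≤N = trans (shiftS-≥ d _ d≤N) (Σ<-cong (suc k) (λ j _ → sym (shiftS-≥ d (F j) d≤N)))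

polySeries-shiftP : ∀ d q → polySeries (shiftP d q) ≈ shiftS d (polySeries q)
polySeries-shiftP zero    q n       = refl
polySeries-shiftP (suc d) q zero    = refl
polySeries-shiftP (suc d) q (suc n) = polySeries-shiftP d q n

coeff-addP : ∀ p q i → coeff (addP p q) i ≡ coeff p i + coeff q i
coeff-addP []      q       i       = sym (ℤ.+-identityˡ _)
coeff-addP (c ∷ p) []      i       = sym (ℤ.+-identityʳ _)
coeff-addP (c ∷ p) (d ∷ q) zero    = refl
coeff-addP (c ∷ p) (d ∷ q) (suc i) = coeff-addP p q i

coeff-negP : ∀ p i → coeff (negP p) i ≡ - coeff p i
coeff-negP []      i       = refl
coeff-negP (c ∷ p) zero    = refl
coeff-negP (c ∷ p) (suc i) = coeff-negP p i

coeff-subP : ∀ p q i → coeff (subP p q) i ≡ coeff p i - coeff q i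
coeff-subP p q i = trans (coeff-addP p (negP q) i) (cong (_+_ (coeff p i)) (coeff-negP q i))

⊙-cong : ∀ p {f g} → f ≈ g → p ⊙ f ≈ p ⊙ g
⊙-cong p eq n = Σ<-cong (suc n) (λ i _ → cong (coeff p i *_) (eq (n ∸ i)))

⊙-negP : ∀ p f n → (negP p ⊙ f) n ≡ - (p ⊙ f) n
⊙-negP p f n = trans (Σ<-cong (suc n) (λ i _ → trans (cong (_* f (n ∸ i)) (coeff-negP p i))
                                                   (sym (ℤ.neg-distribˡ-* (coeff p i) (f (n ∸ i))))))
                     (Σ<-neg (suc n) _)

⊙-subP : ∀ p q f → subP p q ⊙ f ≈ (p ⊙ f) ⊖ (q ⊙ f)
⊙-subP p q f n = trans (Σ<-cong (suc n) (λ i _ → trans (cong (_* f (n ∸ i)) (coeff-subP p q i))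
                                                     ([y-z]x≈yx-zx (f (n ∸ i)) (coeff p i) (coeff q i))))
                       (Σ<-minus (suc n) _ _)

⊙-⊖ : ∀ p f g → p ⊙ (f ⊖ g) ≈ (p ⊙ f) ⊖ (p ⊙ g)
⊙-⊖ p f g n = trans (Σ<-cong (suc n) (λ i _ → x[y-z]≈xy-xz (coeff p i) (f (n ∸ i)) (g (n ∸ i))))
                    (Σ<-minus (suc n) _ _)

⊙-one : ∀ f → (+ 1 ∷ []) ⊙ f ≈ f
⊙-one f n = trans (Σ<-single (suc n) 0 z<s λ { zero _ 0≢0 → contradiction refl 0≢0 ; (suc i) _ _ → refl })
                  (ℤ.*-identityˡ (f n))

⊙-shift₁ : ∀ p f → p ⊙ shift₁ f ≈ shift₁ (p ⊙ f)
⊙-shift₁ p f zero    = trans (ℤ.+-identityˡ _) (ℤ.*-zeroʳ (coeff p 0))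
⊙-shift₁ p f (suc n) = trans (cong₂ _+_ (Σ<-cong (suc n) early) last) (ℤ.+-identityʳ _)
  where
  early : ∀ i → i < suc n → coeff p i * shift₁ f (suc n ∸ i) ≡ coeff p i * f (n ∸ i)
  early i i≤n = cong (λ t → coeff p i * shift₁ f t) (ℕ.+-∸-assoc 1 (ℕ.≤-pred i≤n))
  last : coeff p (suc n) * shift₁ f (n ∸ n) ≡ +0
  last = trans (cong (λ t → coeff p (suc n) * shift₁ f t) (ℕ.n∸n≡0 n)) (ℤ.*-zeroʳ (coeff p (suc n)))

⊙-shiftS : ∀ d p f → p ⊙ shiftS d f ≈ shiftS d (p ⊙ f)
⊙-shiftS zero    p f n = refl
⊙-shiftS (suc d) p f n = trans (⊙-shift₁ p (shiftS d f) n) (shiftS-cong 1 (⊙-shiftS d p f) n)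

⊙-shiftP : ∀ d p f → shiftP d p ⊙ f ≈ shiftS d (p ⊙ f)
⊙-shiftP zero    p f n       = refl
⊙-shiftP (suc d) p f zero    = refl
⊙-shiftP (suc d) p f (suc n) = trans (trans (Σ<-head (suc n) _) (ℤ.+-identityˡ _)) (⊙-shiftP d p f n)

substPow-* : ∀ e .{{_ : NonZero e}} f q → substPow e f (q ℕ.* e) ≡ f q
substPow-* e f q = trans (Σ<-single (suc (q ℕ.* e)) q (s≤s (ℕ.m≤m*n q e)) off)
                         (if-T (ℕ.≡⇒≡ᵇ _ _ (ℕ.*-comm e q)))
  where
  off : ∀ t → t < suc (q ℕ.* e) → t ≢ q → (if e ℕ.* t ≡ᵇ q ℕ.* e then f t else +0) ≡ +0
  off t _ t≢q = if-¬T λ et≡qe →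
    t≢q (ℕ.*-cancelʳ-≡ t q e (trans (ℕ.*-comm t e) (ℕ.≡ᵇ⇒≡ _ _ et≡qe)))

substPow-∤ : ∀ e f {N} → e ∤ N → substPow e f N ≡ +0
substPow-∤ e f {N} e∤N = Σ<-zero (suc N) λ t _ →
  if-¬T (λ et≡N → e∤N (divides t (trans (sym (ℕ.≡ᵇ⇒≡ _ _ et≡N)) (ℕ.*-comm e t))))

substPow-cong : ∀ e {f g} → f ≈ g → substPow e f ≈ substPow e g
substPow-cong e eq N = Σ<-cong (suc N) (λ t _ → cong (λ x → if e ℕ.* t ≡ᵇ N then x else +0) (eq t))

substPow-⊖ : ∀ e f g → substPow e (f ⊖ g) ≈ substPow e f ⊖ substPow e g
substPow-⊖ e f g N = trans (Σ<-cong (suc N) (λ t _ → if-minus (e ℕ.* t ≡ᵇ N))) (Σ<-minus (suc N) _ _)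
  where
  if-minus : ∀ c {x y} → (if c then x - y else +0) ≡ (if c then x else +0) - (if c then y else +0)
  if-minus true  = refl
  if-minus false = refl

substPow-one : ∀ f → substPow 1 f ≈ f
substPow-one f N = trans (cong (substPow 1 f) (sym (ℕ.*-identityʳ N))) (substPow-* 1 f N)

substPow-substPow : ∀ a b .{{_ : NonZero a}} .{{_ : NonZero b}} f →
                    substPow a (substPow b f) ≈ substPow (b ℕ.* a) f
substPow-substPow a b f N with a ∣? N
... | no a∤N = trans (substPow-∤ a _ a∤N) (sym (substPow-∤ (b ℕ.* a) f (a∤N ∘ m*n∣⇒n∣ b a)))
... | yes (divides q refl) with b ∣? q
...   | yes (divides r refl) = begin
  substPow a (substPow b f) (r ℕ.* b ℕ.* a)  ≡⟨ substPow-* a _ (r ℕ.* b) ⟩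
  substPow b f (r ℕ.* b)                     ≡⟨ substPow-* b f r ⟩
  f r                                        ≡⟨ substPow-* (b ℕ.* a) f r ⟨
  substPow (b ℕ.* a) f (r ℕ.* (b ℕ.* a))     ≡⟨ cong (substPow (b ℕ.* a) f) (ℕ.*-assoc r b a) ⟨
  substPow (b ℕ.* a) f (r ℕ.* b ℕ.* a)       ∎
  where instance _ = ℕ.m*n≢0 b a
...   | no b∤q =
  trans (substPow-* a _ q) (trans (substPow-∤ b f b∤q) (sym (substPow-∤ (b ℕ.* a) f ba∤qa)))
  where
  ba∤qa : b ℕ.* a ∤ q ℕ.* a
  ba∤qa = b∤q ∘ *-cancelʳ-∣ a

substPow-shift₁ : ∀ e .{{_ : NonZero e}} g → substPow e (shiftS 1 g) ≈ shiftS e (substPow e g)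
substPow-shift₁ e g N with e ∣? N
... | yes (divides zero refl) = trans (substPow-* e (shiftS 1 g) 0) (sym (shiftS-< e _ (ℕ.>-nonZero⁻¹ e)))
... | yes (divides (suc q) refl) = begin
  substPow e (shiftS 1 g) (suc q ℕ.* e)     ≡⟨ substPow-* e _ (suc q) ⟩
  g q                                       ≡⟨ substPow-* e g q ⟨
  substPow e g (q ℕ.* e)                    ≡⟨ cong (substPow e g) (ℕ.m+n∸m≡n e (q ℕ.* e)) ⟨
  substPow e g (suc q ℕ.* e ∸ e)            ≡⟨ shiftS-≥ e _ (ℕ.m≤m+n e (q ℕ.* e)) ⟨
  shiftS e (substPow e g) (suc q ℕ.* e)     ∎
... | no e∤N with ℕ.<-≤-connex N e
...   | inj₁ N<e = trans (substPow-∤ e _ e∤N) (sym (shiftS-< e _ N<e))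
...   | inj₂ e≤N = trans (substPow-∤ e _ e∤N) (sym (trans (shiftS-≥ e _ e≤N) (substPow-∤ e g e∤N∸e)))
  where
  e∤N∸e : e ∤ N ∸ e
  e∤N∸e e∣N∸e = e∤N (∣m∸n∣n⇒∣m e e≤N e∣N∸e ∣-refl)

count : ∀ {A : Set} → (A → Bool) → List A → ℕ
count p xs = length (filterᵇ p xs)

module _ {A : Set} where

  count-++ : ∀ p (xs ys : List A) → count p (xs ++ ys) ≡ count p xs ℕ.+ count p ys
  count-++ p xs ys = trans (cong length (List.filter-++ (T? ∘ p) xs ys)) (List.length-++ (filterᵇ p xs))

  count-map : ∀ {B : Set} p (f : B → A) xs → count p (map f xs) ≡ count (p ∘ f) xs
  count-map p f []       = refl
  count-map p f (x ∷ xs) with p (f x)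
  ... | true  = cong suc (count-map p f xs)
  ... | false = count-map p f xs

  count-cong : ∀ {p q : A → Bool} → (∀ x → p x ≡ q x) → ∀ xs → count p xs ≡ count q xs
  count-cong         p≗q []       = refl
  count-cong {p} {q} p≗q (x ∷ xs) with p x | q x | p≗q x
  ... | true  | true  | refl = cong suc (count-cong p≗q xs)
  ... | false | false | refl = count-cong p≗q xs

  count-∧ : ∀ c p (xs : List A) → count (λ x → c ∧ p x) xs ≡ (if c then count p xs else 0)
  count-∧ true  p xs = refl
  count-∧ false p xs = count-false xs
    where
    count-false : ∀ (xs : List A) → count (λ _ → false) xs ≡ 0
    count-false []       = refl
    count-false (_ ∷ xs) = count-false xs

  count-concatMap : ∀ {B : Set} p (h : B → List A) xs →
                    count p (concatMap h xs) ≡ sum (map (count p ∘ h) xs)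
  count-concatMap p h []       = refl
  count-concatMap p h (x ∷ xs) =
    trans (count-++ p (h x) _) (cong (count p (h x) ℕ.+_) (count-concatMap p h xs))

sum-applyUpTo-cong : ∀ {f g : ℕ → ℕ} → (∀ i → f i ≡ g i) → ∀ n →
                     sum (applyUpTo f n) ≡ sum (applyUpTo g n)
sum-applyUpTo-cong eq zero    = refl
sum-applyUpTo-cong eq (suc n) = cong₂ ℕ._+_ (eq 0) (sum-applyUpTo-cong (eq ∘ suc) n)

sum-applyUpTo-vanishing : ∀ {g : ℕ → ℕ} {n N} → n ≤ N → (∀ i → n ≤ i → g i ≡ 0) →
                          sum (applyUpTo g N) ≡ sum (applyUpTo g n)
sum-applyUpTo-vanishing {N = zero}  z≤n       _  = refl
sum-applyUpTo-vanishing {N = suc N} z≤n       g₀ =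
  cong₂ ℕ._+_ (g₀ 0 z≤n) (sum-applyUpTo-vanishing {N = N} z≤n (λ i _ → g₀ (suc i) z≤n))
sum-applyUpTo-vanishing {g} (s≤s n≤N) g₀ =
  cong (g 0 ℕ.+_) (sum-applyUpTo-vanishing n≤N (λ i n≤i → g₀ (suc i) (s≤s n≤i)))

≤ᵇ-suc : ∀ a b → (suc a ≤ᵇ suc b) ≡ (a ≤ᵇ b)
≤ᵇ-suc zero    b = refl
≤ᵇ-suc (suc a) b = refl

*-≤ᵇ : ∀ m .{{_ : NonZero m}} x y → (m ℕ.* x ≤ᵇ m ℕ.* y) ≡ (x ≤ᵇ y)
*-≤ᵇ m x y = does-⇔ (mk⇔ (ℕ.*-cancelˡ-≤ m) (ℕ.*-monoʳ-≤ m)) (m ℕ.* x ℕ.≤? m ℕ.* y) (x ℕ.≤? y)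

+-≡ᵇ : ∀ u s n → (u ℕ.+ s ≡ᵇ n) ≡ ((u ≤ᵇ n) ∧ (s ≡ᵇ n ∸ u))
+-≡ᵇ u s n = does-⇔ (mk⇔ split join) (u ℕ.+ s ℕ.≟ n) ((u ℕ.≤? n) ×-dec (s ℕ.≟ n ∸ u))
  where
  split : u ℕ.+ s ≡ n → u ≤ n × s ≡ n ∸ u
  split refl = ℕ.m≤m+n u s , sym (ℕ.m+n∸m≡n u s)
  join : u ≤ n × s ≡ n ∸ u → u ℕ.+ s ≡ n
  join (u≤n , refl) = ℕ.m+[n∸m]≡n u≤n

module Partitions (m : ℕ) (1<m : 1 < m) where

  instance
    m-nonZero : NonZero m
    m-nonZero = >-nonZero (ℕ.<-trans z<s 1<m)

  e<m^e : ∀ e → e < m ^ e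
  e<m^e zero    = z<s
  e<m^e (suc e) = ℕ.≤-<-trans (e<m^e e) (ℕ.^-monoʳ-< m 1<m (ℕ.n<1+n e))

  startsFrom : ℕ → List ℕ → Bool
  startsFrom lo []      = true
  startsFrom lo (e ∷ _) = lo ≤ᵇ e

  PartitionFrom : ℕ → ℕ → List ℕ → Bool
  PartitionFrom lo n es = startsFrom lo es ∧ isPartition m n es

  isPartition≗PartitionFrom0 : ∀ n es → isPartition m n es ≡ PartitionFrom 0 n es
  isPartition≗PartitionFrom0 n []      = refl
  isPartition≗PartitionFrom0 n (_ ∷ _) = refl

  nondecreasing-∷ : ∀ e es → nondecreasing (e ∷ es) ≡ startsFrom e es ∧ nondecreasing es
  nondecreasing-∷ e []      = refl
  nondecreasing-∷ e (_ ∷ _) = refl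

  PartitionFrom-∷ : ∀ lo n e es →
    PartitionFrom lo n (e ∷ es) ≡ ((lo ≤ᵇ e) ∧ (m ^ e ≤ᵇ n)) ∧ PartitionFrom e (n ∸ m ^ e) es
  PartitionFrom-∷ lo n e es
    rewrite nondecreasing-∷ e es | +-≡ᵇ (m ^ e) (sumℕ (map (m ^_) es)) n
    with lo ≤ᵇ e | m ^ e ≤ᵇ n
  ... | false | _     = refl
  ... | true  | true  = ∧-assoc (startsFrom e es) (nondecreasing es) _
  ... | true  | false = ∧-zeroʳ _

  -- nPartitions k lo n counts the partitions of n into k powers m ^ e with e ≥ lo, and
  -- nPartitionsMin k lo n e those into k + 1 such powers whose smallest part is m ^ e.
  nPartitions    : ℕ → ℕ → ℕ → ℕ
  nPartitionsMin : ℕ → ℕ → ℕ → ℕ → ℕ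

  nPartitions zero    lo n = if 0 ≡ᵇ n then 1 else 0
  nPartitions (suc k) lo n = sum (applyUpTo (nPartitionsMin k lo n) (suc n))

  nPartitionsMin k lo n e = if (lo ≤ᵇ e) ∧ (m ^ e ≤ᵇ n) then nPartitions k e (n ∸ m ^ e) else 0

  nPartitionsMin-vanishing : ∀ k lo n e → n ≤ e → nPartitionsMin k lo n e ≡ 0
  nPartitionsMin-vanishing k lo n e n≤e = if-¬T {c = (lo ≤ᵇ e) ∧ (m ^ e ≤ᵇ n)} λ c →
    ℕ.<⇒≱ (e<m^e e) (ℕ.≤-trans (ℕ.≤ᵇ⇒≤ _ _ (proj₂ (Equivalence.to T-∧ c))) n≤e)

  count-PartitionFrom : ∀ k {b} lo n → n ≤ b →
                        count (PartitionFrom lo n) (allLists k b) ≡ nPartitions k lo n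
  count-PartitionFrom zero    lo zero    _   = refl
  count-PartitionFrom zero    lo (suc n) _   = refl
  count-PartitionFrom (suc k) {b} lo n n≤b = begin
    count (PartitionFrom lo n) (allLists (suc k) b)
      ≡⟨ count-concatMap (PartitionFrom lo n) (λ e → map (e ∷_) (allLists k b)) (upTo (suc b)) ⟩
    sum (map firstExponent (upTo (suc b)))
      ≡⟨ cong sum (List.map-upTo firstExponent (suc b)) ⟩
    sum (applyUpTo firstExponent (suc b))
      ≡⟨ sum-applyUpTo-cong count-firstExponent (suc b) ⟩
    sum (applyUpTo (nPartitionsMin k lo n) (suc b))
      ≡⟨ sum-applyUpTo-vanishing (ℕ.m≤n⇒m≤1+n n≤b) (nPartitionsMin-vanishing k lo n) ⟩
    sum (applyUpTo (nPartitionsMin k lo n) n)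
      ≡⟨ sum-applyUpTo-vanishing (ℕ.n≤1+n n) (nPartitionsMin-vanishing k lo n) ⟨
    nPartitions (suc k) lo n
      ∎
    where
    firstExponent : ℕ → ℕ
    firstExponent e = count (PartitionFrom lo n) (map (e ∷_) (allLists k b))

    count-firstExponent : ∀ e → firstExponent e ≡ nPartitionsMin k lo n e
    count-firstExponent e = begin
      count (PartitionFrom lo n) (map (e ∷_) (allLists k b))
        ≡⟨ count-map (PartitionFrom lo n) (e ∷_) (allLists k b) ⟩
      count (PartitionFrom lo n ∘ (e ∷_)) (allLists k b)
        ≡⟨ count-cong (PartitionFrom-∷ lo n e) (allLists k b) ⟩
      count (λ es → ((lo ≤ᵇ e) ∧ (m ^ e ≤ᵇ n)) ∧ PartitionFrom e (n ∸ m ^ e) es) (allLists k b)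
        ≡⟨ count-∧ ((lo ≤ᵇ e) ∧ (m ^ e ≤ᵇ n)) _ (allLists k b) ⟩
      (if (lo ≤ᵇ e) ∧ (m ^ e ≤ᵇ n) then count (PartitionFrom e (n ∸ m ^ e)) (allLists k b) else 0)
        ≡⟨ cong (λ x → if (lo ≤ᵇ e) ∧ (m ^ e ≤ᵇ n) then x else 0)
                (count-PartitionFrom k e (n ∸ m ^ e) (ℕ.≤-trans (ℕ.m∸n≤m n (m ^ e)) n≤b)) ⟩
      nPartitionsMin k lo n e
        ∎

  a≡nPartitions : ∀ k n → a m k n ≡ nPartitions k 0 n
  a≡nPartitions k n =
    trans (count-cong (isPartition≗PartitionFrom0 n) (allLists k n)) (count-PartitionFrom k 0 n ℕ.≤-refl)

  a-suc-suc : ∀ k n → a m (suc k) (suc n) ≡ a m k n ℕ.+ nPartitions (suc k) 1 (suc n)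
  a-suc-suc k n = begin
    a m (suc k) (suc n)                                  ≡⟨ a≡nPartitions (suc k) (suc n) ⟩
    nPartitions (suc k) 0 (suc n)                        ≡⟨⟩  -- split off the term e = 0
    nPartitions k 0 n ℕ.+ nPartitions (suc k) 1 (suc n)  ≡⟨ cong (ℕ._+ nPartitions (suc k) 1 (suc n))
                                                                  (a≡nPartitions k n) ⟨
    a m k n ℕ.+ nPartitions (suc k) 1 (suc n)            ∎

  nPartitions-* : ∀ k lo q → nPartitions k (suc lo) (m ℕ.* q) ≡ nPartitions k lo q
  nPartitions-* zero lo q = if-cong (does-⇔ (mk⇔ to from) (0 ℕ.≟ m ℕ.* q) (0 ℕ.≟ q))
    where
    to : 0 ≡ m ℕ.* q → 0 ≡ q
    to 0≡mq = sym (ℕ.m*n≡0⇒m≡0 q m (trans (ℕ.*-comm q m) (sym 0≡mq)))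
    from : 0 ≡ q → 0 ≡ m ℕ.* q
    from refl = sym (ℕ.*-zeroʳ m)
  nPartitions-* (suc k) lo q = begin
    -- the term e = 0 vanishes because all exponents are ≥ 1 + lo
    sum (applyUpTo (nPartitionsMin k (suc lo) (m ℕ.* q) ∘ suc) (m ℕ.* q))
      ≡⟨ sum-applyUpTo-cong min-* (m ℕ.* q) ⟩
    sum (applyUpTo (nPartitionsMin k lo q) (m ℕ.* q))
      ≡⟨ sum-applyUpTo-vanishing (ℕ.m≤n*m q m) (nPartitionsMin-vanishing k lo q) ⟩
    sum (applyUpTo (nPartitionsMin k lo q) q)
      ≡⟨ sum-applyUpTo-vanishing (ℕ.n≤1+n q) (nPartitionsMin-vanishing k lo q) ⟨
    nPartitions (suc k) lo q
      ∎
    where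
    min-* : ∀ e → nPartitionsMin k (suc lo) (m ℕ.* q) (suc e) ≡ nPartitionsMin k lo q e
    min-* e = cong₂ (λ c x → if c then x else 0)
                    (cong₂ _∧_ (≤ᵇ-suc lo e) (*-≤ᵇ m (m ^ e) q))
                    (trans (cong (nPartitions k (suc e)) (sym (ℕ.*-distribˡ-∸ m q (m ^ e))))
                           (nPartitions-* k e (q ∸ m ^ e)))

  nPartitions-∤ : ∀ k lo {n} → m ∤ n → nPartitions k (suc lo) n ≡ 0
  nPartitions-∤ zero    lo {zero}  m∤0 = contradiction (m ∣0) m∤0
  nPartitions-∤ zero    lo {suc n} _   = refl
  nPartitions-∤ (suc k) lo {n}     m∤n = sum-applyUpTo-vanishing {N = suc n} z≤n min≡0
    where
    min≡0 : ∀ e → 0 ≤ e → nPartitionsMin k (suc lo) n e ≡ 0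
    min≡0 zero    _ = refl
    min≡0 (suc e) _ = if-else-≡ λ c → nPartitions-∤ k e λ m∣n∸m^[1+e] →
      let m^[1+e]≤n = ℕ.≤ᵇ⇒≤ _ _ (proj₂ (Equivalence.to T-∧ c))
      in m∤n (∣m∸n∣n⇒∣m m m^[1+e]≤n m∣n∸m^[1+e] (m∣m*n (m ^ e)))

  a-suc-suc-∣ : ∀ k n q → suc n ≡ q ℕ.* m → a m (suc k) (suc n) ≡ a m k n ℕ.+ a m (suc k) q
  a-suc-suc-∣ k n q n+1≡qm = begin
    a m (suc k) (suc n)                                  ≡⟨ a-suc-suc k n ⟩
    a m k n ℕ.+ nPartitions (suc k) 1 (suc n)            ≡⟨ cong (λ N → a m k n ℕ.+ nPartitions (suc k) 1 N)
                                                                  (trans n+1≡qm (ℕ.*-comm q m)) ⟩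
    a m k n ℕ.+ nPartitions (suc k) 1 (m ℕ.* q)          ≡⟨ cong (a m k n ℕ.+_) (nPartitions-* (suc k) 0 q) ⟩
    a m k n ℕ.+ nPartitions (suc k) 0 q                  ≡⟨ cong (a m k n ℕ.+_) (a≡nPartitions (suc k) q) ⟨
    a m k n ℕ.+ a m (suc k) q                            ∎

  a-suc-suc-∤ : ∀ k n → m ∤ suc n → a m (suc k) (suc n) ≡ a m k n
  a-suc-suc-∤ k n m∤n+1 = trans (a-suc-suc k n)
    (trans (cong (a m k n ℕ.+_) (nPartitions-∤ (suc k) 0 m∤n+1)) (ℕ.+-identityʳ _))

  A-recurrence : ∀ k → shiftS 1 (A m k) ≈ A m (suc k) ⊖ substPow m (A m (suc k))
  A-recurrence k zero = sym (trans (cong (_-_ (A m (suc k) 0)) (substPow-* m (A m (suc k)) 0))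
                                   (ℤ.+-inverseʳ (A m (suc k) 0)))
  A-recurrence k (suc n) with m ∣? suc n
  ... | yes (divides q n+1≡qm) = begin
    + a m k n                                                 ≡⟨ x≡x+y-y (+ a m k n) (+ r) ⟩
    + a m k n + + r - + r                                     ≡⟨ cong (_- + r) (ℤ.pos-+ (a m k n) r) ⟨
    + (a m k n ℕ.+ r) - + r
      ≡⟨ cong₂ (λ x y → + x - y) (a-suc-suc-∣ k n q n+1≡qm) substPow-q ⟨
    + a m (suc k) (suc n) - substPow m (A m (suc k)) (suc n)  ∎
    where
    r : ℕ
    r = a m (suc k) q
    x≡x+y-y : ∀ x y → x ≡ x + y - y
    x≡x+y-y = solve-∀
    substPow-q : substPow m (A m (suc k)) (suc n) ≡ + r
    substPow-q = trans (cong (substPow m (A m (suc k))) n+1≡qm) (substPow-* m (A m (suc k)) q)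
  ... | no m∤n+1 = begin
    + a m k n                                                 ≡⟨ cong +_ (a-suc-suc-∤ k n m∤n+1) ⟨
    + a m (suc k) (suc n)                                     ≡⟨ ℤ.+-identityʳ _ ⟨
    + a m (suc k) (suc n) - +0
      ≡⟨ cong (_-_ (+ a m (suc k) (suc n))) (substPow-∤ m (A m (suc k)) m∤n+1) ⟨
    + a m (suc k) (suc n) - substPow m (A m (suc k)) (suc n)  ∎

module FunctionalEquation (m : ℕ) .{{_ : NonZero m}} where

  L : ℕ → Series → Series
  L k F = ΣS≤ k (λ j → P m k j ⊙ substPow (m ^ j) F) ⊕ polySeries (Q m k)

  P-suc-suc-< : ∀ {j k} → j < k → P m (suc k) (suc j) ≡
                subP (shiftP (m ^ k ∸ m ^ suc j) (P m k (suc j))) (shiftP (m ^ k ∸ m ^ j) (P m k j))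
  P-suc-suc-< {j} {k} j<k = trans (if-¬T (λ j≡k → ℕ.<⇒≢ j<k (ℕ.≡ᵇ⇒≡ j k j≡k))) (if-T (ℕ.<⇒<ᵇ j<k))

  P-suc-diag : ∀ k → P m (suc k) (suc k) ≡ negP (P m k k)
  P-suc-diag k = if-T (ℕ.≡⇒≡ᵇ k k refl)

  shiftS-substPow-m^ : ∀ j {F G} → shiftS 1 G ≈ F ⊖ substPow m F →
                       shiftS (m ^ j) (substPow (m ^ j) G) ≈ substPow (m ^ j) F ⊖ substPow (m ^ suc j) F
  shiftS-substPow-m^ j {F} {G} rec N = begin
    shiftS (m ^ j) (substPow (m ^ j) G) N                   ≡⟨ substPow-shift₁ (m ^ j) G N ⟨
    substPow (m ^ j) (shiftS 1 G) N                         ≡⟨ substPow-cong (m ^ j) rec N ⟩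
    substPow (m ^ j) (F ⊖ substPow m F) N                   ≡⟨ substPow-⊖ (m ^ j) F (substPow m F) N ⟩
    (substPow (m ^ j) F ⊖ substPow (m ^ j) (substPow m F)) N ≡⟨ cong (_-_ (substPow (m ^ j) F N))
                                                                     (substPow-substPow (m ^ j) m F N) ⟩
    (substPow (m ^ j) F ⊖ substPow (m ^ suc j) F) N         ∎
    where instance _ = ℕ.m^n≢0 m j

  L-suc : ∀ k {F G} → shiftS 1 G ≈ F ⊖ substPow m F → L (suc k) F ≈ shiftS (m ^ k) (L k G)
  L-suc k {F} {G} rec n = begin
    L (suc k) F n
      ≡⟨⟩
    Σ< (suc (suc k)) w + coeff (Q m (suc k)) n
      ≡⟨ cong₂ _+_ (Σ<-by-parts k u v w refl w-suc w-last) (polySeries-shiftP (m ^ k) (Q m k) n) ⟩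
    Σ< (suc k) (λ j → u j - v j) + Qₖ
      ≡⟨ cong (_+ Qₖ) (Σ<-cong (suc k) (λ j j<1+k → shifted-term j (ℕ.≤-pred j<1+k))) ⟨
    Σ< (suc k) (λ j → shiftS (m ^ k) (Gⱼ j) n) + Qₖ
      ≡⟨ cong (_+ Qₖ) (shiftS-ΣS≤ (m ^ k) k Gⱼ n) ⟨
    shiftS (m ^ k) (ΣS≤ k Gⱼ) n + Qₖ
      ≡⟨ shiftS-⊕ (m ^ k) (ΣS≤ k Gⱼ) (polySeries (Q m k)) n ⟨
    shiftS (m ^ k) (L k G) n
      ∎
    where
    Qₖ : ℤ
    Qₖ = shiftS (m ^ k) (polySeries (Q m k)) n
    Gⱼ S : ℕ → Series
    Gⱼ j = P m k j ⊙ substPow (m ^ j) G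
    S j = substPow (m ^ j) F
    c : ℕ → Poly
    c j = shiftP (m ^ k ∸ m ^ j) (P m k j)
    u v w : ℕ → ℤ
    u j = (c j ⊙ S j) n
    v j = (c j ⊙ S (suc j)) n
    w j = (P m (suc k) j ⊙ S j) n

    w-suc : ∀ j → j < k → w (suc j) ≡ u (suc j) - v j
    w-suc j j<k = trans (cong (λ p → (p ⊙ S (suc j)) n) (P-suc-suc-< j<k))
                        (⊙-subP (c (suc j)) (c j) (S (suc j)) n)

    w-last : w (suc k) ≡ - v k
    w-last = begin
      (P m (suc k) (suc k) ⊙ S (suc k)) n  ≡⟨ cong (λ p → (p ⊙ S (suc k)) n) (P-suc-diag k) ⟩
      (negP (P m k k) ⊙ S (suc k)) n       ≡⟨ ⊙-negP (P m k k) (S (suc k)) n ⟩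
      - (P m k k ⊙ S (suc k)) n            ≡⟨ cong (λ d → - (shiftP d (P m k k) ⊙ S (suc k)) n)
                                                     (ℕ.n∸n≡0 (m ^ k)) ⟨
      - v k                                ∎

    shifted-term : ∀ j → j ≤ k → shiftS (m ^ k) (Gⱼ j) n ≡ u j - v j
    shifted-term j j≤k = begin
      shiftS (m ^ k) (Gⱼ j) n
        ≡⟨ cong (λ d → shiftS d (Gⱼ j) n) (ℕ.m∸n+n≡m (ℕ.^-monoʳ-≤ m j≤k)) ⟨
      shiftS (m ^ k ∸ m ^ j ℕ.+ m ^ j) (Gⱼ j) n
        ≡⟨ shiftS-+ (m ^ k ∸ m ^ j) (m ^ j) (Gⱼ j) n ⟩
      shiftS (m ^ k ∸ m ^ j) (shiftS (m ^ j) (Gⱼ j)) n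
        ≡⟨ shiftS-cong (m ^ k ∸ m ^ j) (⊙-shiftS (m ^ j) (P m k j) (substPow (m ^ j) G)) n ⟨
      shiftS (m ^ k ∸ m ^ j) (P m k j ⊙ shiftS (m ^ j) (substPow (m ^ j) G)) n
        ≡⟨ ⊙-shiftP (m ^ k ∸ m ^ j) (P m k j) (shiftS (m ^ j) (substPow (m ^ j) G)) n ⟨
      (c j ⊙ shiftS (m ^ j) (substPow (m ^ j) G)) n
        ≡⟨ ⊙-cong (c j) (shiftS-substPow-m^ j rec) n ⟩
      (c j ⊙ (S j ⊖ S (suc j))) n
        ≡⟨ ⊙-⊖ (c j) (S j) (S (suc j)) n ⟩
      u j - v j
        ∎

  L-zero : L 0 (A m 0) ≈ 0S
  L-zero zero    = refl
  L-zero (suc n) = trans (ℤ.+-identityʳ _) (trans (ℤ.+-identityˡ _)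
                     (trans (⊙-one (substPow 1 (A m 0)) (suc n)) (substPow-one (A m 0) (suc n))))

module _ (m : ℕ) (1<m : 1 < m) where

  open Partitions m 1<m using (m-nonZero; A-recurrence)
  open FunctionalEquation m

  L-A≈0 : ∀ k → L k (A m k) ≈ 0S
  L-A≈0 zero      = L-zero
  L-A≈0 (suc k) n = begin
    L (suc k) (A m (suc k)) n          ≡⟨ L-suc k (A-recurrence k) n ⟩
    shiftS (m ^ k) (L k (A m k)) n     ≡⟨ shiftS-cong (m ^ k) (L-A≈0 k) n ⟩
    shiftS (m ^ k) 0S n                ≡⟨ shiftS-0S (m ^ k) n ⟩
    +0                                 ∎

-- The identity also holds for k = 0.
theorem6p5 : (m k : ℕ) → 2 ≤ m → 1 ≤ k → (n : ℕ) → LHS m k n ≡ + 0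
theorem6p5 m k 1<m _ = L-A≈0 m 1<m k
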